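{- Let $G$ be a $2$-tree of order $n\ge 3$. Then \[\bar{\kappa}_{\max}(G)\ge 1+\frac{n-3}{n(n-1)},\] and this bound is sharp for all $n$: for every $n\ge 3$ there is a $2$-tree of order $n$ attaining equality.
   Context: Graphs are finite and simple. $2$-trees are defined recursively: $K_2$ is a $2$-tree, and if $T$ is a $2$-tree, then the graph obtained from $T$ by adding a new vertex adjacent to both ends of some edge of $T$ is a $2$-tree. An orientation of $G$ is obtained by directing each edge. For a digraph $D$ and distinct vertices $u,v$, $\kappa_D(u,v)$ is the maximum number of internally disjoint directed $u$--$v$ paths; for $D$ of order $n$, $\bar{\kappa}(D)=\frac{1}{n(n-1)}\sum_{(u,v)}\kappa_D(u,v)$ over ordered pairs of distinct vertices; $\bar{\kappa}_{\max}(G)$ is the maximum of $\bar{\kappa}(D)$ over all orientations $D$ of $G$. -}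

module Defs where

open import Data.Nat using (ℕ; zero; suc; _+_; _*_; _∸_; _≤_)
open import Data.Fin using (Fin; inject₁; fromℕ; _≟_)
open import Data.Fin.Permutation using (Permutation′; _⟨$⟩ʳ_)
open import Data.List using (List; []; _∷_; _++_; map; allFin)
open import Data.Nat.ListAction using (sum)
open import Data.List.Membership.Propositional using (_∈_)
open import Data.List.Relation.Unary.Unique.Propositional using (Unique)
open import Data.Product using (_×_; Σ; ∃)
open import Data.Sum using (_⊎_)
open import Data.Empty using (⊥)
open import Relation.Nullary using (¬_; yes; no)
open import Relation.Binary.PropositionalEquality using (_≡_; _≢_)
open import Function.Bundles using (_⇔_)

record Graph (n : ℕ) : Set₁ where
  field
    Adj    : Fin n → Fin n → Set
    sym    : ∀ {i j} → Adj i j → Adj j i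
    irrefl : ∀ {i} → ¬ Adj i i
open Graph public

data IsTwoTree : (n : ℕ) → Graph n → Set₁ where
  base : (G : Graph 2) → (∀ i j → Adj G i j ⇔ (i ≢ j)) → IsTwoTree 2 G
  step : ∀ {n} (G : Graph n) → IsTwoTree n G →
         (x y : Fin n) → Adj G x y →
         (H : Graph (suc n)) →
         (∀ i j → Adj H (inject₁ i) (inject₁ j) ⇔ Adj G i j) →
         (∀ i → Adj H (fromℕ n) (inject₁ i) ⇔ (i ≡ x ⊎ i ≡ y)) →
         IsTwoTree (suc n) H
  iso  : ∀ {n} (G : Graph n) → IsTwoTree n G →
         (H : Graph n) (π : Permutation′ n) →
         (∀ i j → Adj H i j ⇔ Adj G (π ⟨$⟩ʳ i) (π ⟨$⟩ʳ j)) →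
         IsTwoTree n H

record Orientation {n : ℕ} (G : Graph n) : Set₁ where
  field
    Arc      : Fin n → Fin n → Set
    arc-edge : ∀ {u v} → Arc u v → Adj G u v
    edge-arc : ∀ {u v} → Adj G u v → Arc u v ⊎ Arc v u
    antisym  : ∀ {u v} → Arc u v → Arc v u → ⊥
open Orientation public

ArcChain : ∀ {n} {G : Graph n} → Orientation G → Fin n → List (Fin n) → Fin n → Set
ArcChain D u []       v = Arc D u v
ArcChain D u (w ∷ ws) v = Arc D u w × ArcChain D w ws v

record Path {n} {G : Graph n} (D : Orientation G) (u v : Fin n) : Set where
  field
    interior : List (Fin n)
    chain    : ArcChain D u interior v
    distinct : Unique (u ∷ interior ++ v ∷ [])
open Path public

HasDisjointPaths : ∀ {n} {G : Graph n} → Orientation G → Fin n → Fin n → ℕ → Set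
HasDisjointPaths {n} D u v k =
  Σ (Fin k → Path D u v) λ ps →
    ∀ i j → i ≢ j →
      (interior (ps i) ≢ interior (ps j)) ×
      (∀ w → w ∈ interior (ps i) → w ∈ interior (ps j) → ⊥)

IsKappa : ∀ {n} {G : Graph n} → Orientation G → Fin n → Fin n → ℕ → Set
IsKappa D u v k = HasDisjointPaths D u v k × (∀ m → HasDisjointPaths D u v m → m ≤ k)

pairSum : ∀ {n} → (Fin n → Fin n → ℕ) → ℕ
pairSum {n} f = sum (map (λ u → sum (map (λ v → term u v) (allFin n))) (allFin n))
  where
  term : Fin n → Fin n → ℕ
  term u v with u ≟ v
  ... | yes _ = 0
  ... | no  _ = f u v

KappaOf : ∀ {n} {G : Graph n} → Orientation G → (Fin n → Fin n → ℕ) → Set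
KappaOf {n} D κ = ∀ (u v : Fin n) → u ≢ v → IsKappa D u v (κ u v)

-- n(n-1) + (n-3): the bound 1 + (n-3)/(n(n-1)) multiplied by n(n-1)
bound : ℕ → ℕ
bound n = n * (n ∸ 1) + (n ∸ 3)

-- Orient a 2-tree along its construction: a triangle cyclically, and a vertex z attached
-- to an edge already oriented a → b as a → z → b.  The orientation stays strongly connected, every old
-- pair keeps its disjoint paths, the pair (a, b) gains the path a → z → b, and each of the 2n pairs
-- involving z has a path; so Σ κ grows by at least 2n + 1 ≥ bound (n + 1) − bound n.
--
-- In the book (the edge {0, 1} plus n − 2 vertices adjacent to exactly 0 and 1), any
-- orientation has κ(u, v) + κ(v, u) ≤ deg u: paths from u leave through distinct out-neighbours of u,
-- paths into u arrive through distinct in-neighbours, and no neighbour is both.  This gives 2 for every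
-- pair containing a page vertex and n − 1 for the pair {0, 1}, hence 2 Σ κ ≤ 2 bound n.
--
-- Because κ has to be exhibited as a function, κ_D(u, v) is computed as the clique number of the
-- relation "disjoint interiors" on the finitely many interiors of u–v paths.

module Submission where

open import Defs
open import Data.Nat using (ℕ; zero; suc; _+_; _*_; _≤_; _⊔_; z≤n; s≤s)
open import Data.Nat.Properties
  using ( ≤-refl; ≤-trans; ≤-reflexive; ≤-antisym; m≤m+n; n≤1+n; m≤n⇒m≤1+n; m≤m⊔n; m≤n⊔m; ⊔-sel
        ; +-comm; +-identityʳ; *-identityʳ; +-mono-≤; +-monoˡ-≤; +-monoʳ-≤; *-cancelˡ-≤
        ; +-0-commutativeMonoid; module ≤-Reasoning)
open import Data.Nat.Tactic.RingSolver using (solve-∀)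
import Data.Nat.ListAction as List
open import Algebra.Properties.CommutativeMonoid.Sum +-0-commutativeMonoid
  using (sum; sum-syntax; sum-cong-≗; sum-remove; sum-replicate-zero; ∑-distrib-+; ∑-comm; sum-permute; sum-init-last)
open import Data.Fin using (Fin; zero; suc; _≟_; inject₁; fromℕ; punchIn; splitAt; join)
open import Data.Fin.Properties using (punchInᵢ≢i; inject₁-injective; fromℕ≢inject₁; join-splitAt; injective⇒≤)
open import Data.Fin.Permutation using (Permutation′; _⟨$⟩ʳ_; _⟨$⟩ˡ_; inverseˡ; inverseʳ) renaming (flip to inverse)
open import Data.Fin.Relation.Unary.Top using (View; view; ‵fromℕ; ‵inject₁; view-inject₁; view-fromℕ)
open import Data.List
  using (List; []; _∷_; _++_; map; length; filter; lookup; tabulate; allFin; cartesianProductWith)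
open import Data.List.Properties
  using ( map-tabulate; map-cong; map-++; map-injective; ≡-dec; length-tabulate; length-++-sucʳ
        ; length-filter; length-++-≤ˡ)
open import Data.List.Membership.Propositional using (_∈_; _∉_)
open import Data.List.Membership.Propositional.Properties
  using ( ∈-++⁺ˡ; ∈-++⁺ʳ; ∈-++⁻; ∈-map⁻; ∈-filter⁺; ∈-filter⁻; ∈-∃++; ∈-lookup; ∈-tabulate⁻; ∈-allFin
        ; ∈-cartesianProductWith⁺)
open import Data.List.Membership.DecPropositional using () renaming (_∈?_ to member?)
open import Data.List.Relation.Binary.Subset.Propositional using (_⊆_)
open import Data.List.Relation.Binary.Disjoint.DecPropositional using (disjoint?)
open import Data.List.Relation.Binary.Permutation.Setoid.Properties using (AllPairs-resp-↭; shift)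
open import Data.List.Relation.Unary.Any using (here; there)
open import Data.List.Relation.Unary.All as All using (All; []; _∷_)
open import Data.List.Relation.Unary.All.Properties using (¬Any⇒All¬)
open import Data.List.Relation.Unary.AllPairs using (AllPairs; []; _∷_)
import Data.List.Relation.Unary.AllPairs as AllPairs
import Data.List.Relation.Unary.AllPairs.Properties as AllPairs
open import Data.List.Relation.Unary.Unique.Propositional using (Unique)
import Data.List.Relation.Unary.Unique.Propositional.Properties as Unique
import Data.List.Relation.Unary.Unique.DecPropositional as Unique
open import Data.Unit using (⊤; tt)
open import Data.Empty using (⊥; ⊥-elim)
open import Data.Sum as ⊎ using (_⊎_; inj₁; inj₂)
open import Data.Product using (Σ; ∃; _×_; _,_; proj₁; proj₂)
open import Function using (id; _∘_; flip; _on_)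
open import Function.Bundles using (_⇔_; mk⇔; Injection; module Equivalence)
open import Function.Definitions using (Injective)
open import Function.Properties.Inverse using (↔⇒↣)
open import Level using (0ℓ)
open import Relation.Nullary using (Dec; yes; no; ¬_)
open import Relation.Nullary.Decidable using (_×-dec_; ¬?; map′)
open import Relation.Binary using (Rel; Decidable; DecidableEquality; Symmetric)
open import Relation.Binary.PropositionalEquality as ≡
  using (_≡_; _≢_; refl; cong; cong₂; subst; subst₂; module ≡-Reasoning)

open Equivalence using (to; from)

-- Sums over ordered pairs of distinct vertices

sum-mono-≤ : ∀ {n} {f g : Fin n → ℕ} → (∀ i → f i ≤ g i) → sum f ≤ sum g
sum-mono-≤ {zero}  _   = z≤n
sum-mono-≤ {suc n} f≤g = +-mono-≤ (f≤g zero) (sum-mono-≤ (f≤g ∘ suc))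

sum-const : ∀ n c → ∑[ i < n ] c ≡ n * c
sum-const zero    c = refl
sum-const (suc n) c = cong (c +_) (sum-const n c)

≤-sum : ∀ {n} (f : Fin n → ℕ) i → f i ≤ sum f
≤-sum {suc n} f i = ≤-trans (m≤m+n (f i) _) (≤-reflexive (≡.sym (sum-remove {i = i} f)))

sum-tabulate : ∀ {n} (f : Fin n → ℕ) → List.sum (tabulate f) ≡ sum f
sum-tabulate {zero}  f = refl
sum-tabulate {suc n} f = cong (f zero +_) (sum-tabulate (f ∘ suc))

sum-map-allFin : ∀ {n} (f : Fin n → ℕ) → List.sum (map f (allFin n)) ≡ sum f
sum-map-allFin f = ≡.trans (cong List.sum (map-tabulate id f)) (sum-tabulate f)

permute-injective : ∀ {n} (π : Permutation′ n) → Injective _≡_ _≡_ (π ⟨$⟩ʳ_)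
permute-injective π = Injection.injective (↔⇒↣ π)

offDiagonal : ∀ {n} → (Fin n → Fin n → ℕ) → Fin n → Fin n → ℕ
offDiagonal f u v with u ≟ v
... | yes _ = 0
... | no  _ = f u v

offDiagonal-reindex : ∀ {m n} (f : Fin n → Fin n → ℕ) {φ : Fin m → Fin n} → Injective _≡_ _≡_ φ →
                      ∀ u v → offDiagonal (f on φ) u v ≡ offDiagonal f (φ u) (φ v)
offDiagonal-reindex f {φ} φ-inj u v with u ≟ v | φ u ≟ φ v
... | yes _   | yes _     = refl
... | no  _   | no  _     = refl
... | yes u≡v | no  φu≢φv = ⊥-elim (φu≢φv (cong φ u≡v))
... | no  u≢v | yes φu≡φv = ⊥-elim (u≢v (φ-inj φu≡φv))

module _ {n : ℕ} where

  offDiagonal-diag : ∀ (f : Fin n → Fin n → ℕ) u → offDiagonal f u u ≡ 0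
  offDiagonal-diag f u with u ≟ u
  ... | yes _   = refl
  ... | no  u≢u = ⊥-elim (u≢u refl)

  offDiagonal-off : ∀ (f : Fin n → Fin n → ℕ) {u v} → u ≢ v → offDiagonal f u v ≡ f u v
  offDiagonal-off f {u} {v} u≢v with u ≟ v
  ... | yes u≡v = ⊥-elim (u≢v u≡v)
  ... | no  _   = refl

  offDiagonal-≤ : ∀ (f : Fin n → Fin n → ℕ) u v → offDiagonal f u v ≤ f u v
  offDiagonal-≤ f u v with u ≟ v
  ... | yes _ = z≤n
  ... | no  _ = ≤-refl

  offDiagonal-mono-≤ : ∀ {f g : Fin n → Fin n → ℕ} → (∀ u v → u ≢ v → f u v ≤ g u v) →
                       ∀ u v → offDiagonal f u v ≤ offDiagonal g u v
  offDiagonal-mono-≤ f≤g u v with u ≟ v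
  ... | yes _   = z≤n
  ... | no  u≢v = f≤g u v u≢v

  offDiagonal-+ : ∀ (f g : Fin n → Fin n → ℕ) u v →
                  offDiagonal (λ u v → f u v + g u v) u v ≡ offDiagonal f u v + offDiagonal g u v
  offDiagonal-+ f g u v with u ≟ v
  ... | yes _ = refl
  ... | no  _ = refl

  offDiagonal-flip : ∀ (f : Fin n → Fin n → ℕ) u v → offDiagonal (flip f) u v ≡ offDiagonal f v u
  offDiagonal-flip f u v with u ≟ v | v ≟ u
  ... | yes _   | yes _   = refl
  ... | no  _   | no  _   = refl
  ... | yes u≡v | no  v≢u = ⊥-elim (v≢u (≡.sym u≡v))
  ... | no  u≢v | yes v≡u = ⊥-elim (u≢v (≡.sym v≡u))

  mutual
    pairSum≡∑∑ : ∀ (f : Fin n → Fin n → ℕ) → pairSum f ≡ ∑[ u < n ] ∑[ v < n ] offDiagonal f u v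
    pairSum≡∑∑ f = ≡.trans
      (cong List.sum (map-cong (λ u → ≡.trans (cong List.sum (map-cong (summand≡offDiagonal f u) (allFin n)))
                                              (sum-map-allFin (offDiagonal f u))) (allFin n)))
      (sum-map-allFin {n} (λ u → ∑[ v < n ] offDiagonal f u v))

    -- `_` is the summand local to `pairSum`, which cannot be named here.
    summand≡offDiagonal : ∀ (f : Fin n → Fin n → ℕ) u v → _ ≡ offDiagonal f u v
    summand≡offDiagonal f u v with u ≟ v
    ... | yes _ = refl
    ... | no  _ = refl

  pairSum-mono-≤ : ∀ {f g : Fin n → Fin n → ℕ} → (∀ u v → u ≢ v → f u v ≤ g u v) → pairSum f ≤ pairSum g
  pairSum-mono-≤ {f} {g} f≤g rewrite pairSum≡∑∑ f | pairSum≡∑∑ g =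
    sum-mono-≤ (λ u → sum-mono-≤ (offDiagonal-mono-≤ f≤g u))

  pairSum-+ : ∀ (f g : Fin n → Fin n → ℕ) → pairSum (λ u v → f u v + g u v) ≡ pairSum f + pairSum g
  pairSum-+ f g = begin
    pairSum (λ u v → f u v + g u v)
      ≡⟨ pairSum≡∑∑ (λ u v → f u v + g u v) ⟩
    ∑[ u < n ] ∑[ v < n ] offDiagonal (λ u v → f u v + g u v) u v
      ≡⟨ sum-cong-≗ (λ u → ≡.trans (sum-cong-≗ (offDiagonal-+ f g u))
                                    (∑-distrib-+ (offDiagonal f u) (offDiagonal g u))) ⟩
    ∑[ u < n ] (∑[ v < n ] offDiagonal f u v + ∑[ v < n ] offDiagonal g u v)
      ≡⟨ ∑-distrib-+ (λ u → ∑[ v < n ] offDiagonal f u v) (λ u → ∑[ v < n ] offDiagonal g u v) ⟩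
    ∑[ u < n ] ∑[ v < n ] offDiagonal f u v + ∑[ u < n ] ∑[ v < n ] offDiagonal g u v
      ≡⟨ cong₂ _+_ (pairSum≡∑∑ f) (pairSum≡∑∑ g) ⟨
    pairSum f + pairSum g ∎
    where open ≡-Reasoning

  pairSum-flip : ∀ (f : Fin n → Fin n → ℕ) → pairSum (flip f) ≡ pairSum f
  pairSum-flip f = begin
    pairSum (flip f)                              ≡⟨ pairSum≡∑∑ (flip f) ⟩
    ∑[ u < n ] ∑[ v < n ] offDiagonal (flip f) u v ≡⟨ sum-cong-≗ (λ u → sum-cong-≗ (offDiagonal-flip f u)) ⟩
    ∑[ u < n ] ∑[ v < n ] offDiagonal f v u        ≡⟨ ∑-comm (offDiagonal f) ⟨
    ∑[ v < n ] ∑[ u < n ] offDiagonal f v u        ≡⟨ pairSum≡∑∑ f ⟨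
    pairSum f                                      ∎
    where open ≡-Reasoning

  ≤-pairSum : ∀ (f : Fin n → Fin n → ℕ) {u v} → u ≢ v → f u v ≤ pairSum f
  ≤-pairSum f {u} {v} u≢v = begin
    f u v                                          ≡⟨ offDiagonal-off f u≢v ⟨
    offDiagonal f u v                              ≤⟨ ≤-sum _ v ⟩
    ∑[ v < n ] offDiagonal f u v                   ≤⟨ ≤-sum _ u ⟩
    ∑[ u < n ] ∑[ v < n ] offDiagonal f u v        ≡⟨ pairSum≡∑∑ f ⟨
    pairSum f                                      ∎
    where open ≤-Reasoning

  pairSum-permute : ∀ (π : Permutation′ n) (f : Fin n → Fin n → ℕ) → pairSum (f on (π ⟨$⟩ʳ_)) ≡ pairSum f
  pairSum-permute π f = begin
    pairSum (f on σ)
      ≡⟨ pairSum≡∑∑ (f on σ) ⟩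
    ∑[ u < n ] ∑[ v < n ] offDiagonal (f on σ) u v
      ≡⟨ sum-cong-≗ (λ u → sum-cong-≗ (offDiagonal-reindex f (permute-injective π) u)) ⟩
    ∑[ u < n ] ∑[ v < n ] offDiagonal f (σ u) (σ v)
      ≡⟨ sum-cong-≗ (λ u → sum-permute (offDiagonal f (σ u)) π) ⟨
    ∑[ u < n ] ∑[ v < n ] offDiagonal f (σ u) v
      ≡⟨ sum-permute (λ u → ∑[ v < n ] offDiagonal f u v) π ⟨
    ∑[ u < n ] ∑[ v < n ] offDiagonal f u v
      ≡⟨ pairSum≡∑∑ f ⟨
    pairSum f ∎
    where
    open ≡-Reasoning
    σ : Fin n → Fin n
    σ = π ⟨$⟩ʳ_

pairSum-const : ∀ n c → pairSum {suc n} (λ _ _ → c) ≡ suc n * (n * c)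
pairSum-const n c = begin
  pairSum {suc n} (λ _ _ → c)                                ≡⟨ pairSum≡∑∑ {suc n} (λ _ _ → c) ⟩
  ∑[ u < suc n ] ∑[ v < suc n ] offDiagonal (λ _ _ → c) u v   ≡⟨ sum-cong-≗ row ⟩
  ∑[ u < suc n ] (n * c)                                     ≡⟨ sum-const (suc n) (n * c) ⟩
  suc n * (n * c)                                            ∎
  where
  open ≡-Reasoning
  row : ∀ u → ∑[ v < suc n ] offDiagonal (λ _ _ → c) u v ≡ n * c
  row u = begin
    ∑[ v < suc n ] offDiagonal (λ _ _ → c) u v
      ≡⟨ sum-remove {i = u} (offDiagonal (λ _ _ → c) u) ⟩
    offDiagonal (λ _ _ → c) u u + ∑[ j < n ] offDiagonal (λ _ _ → c) u (punchIn u j)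
      ≡⟨ cong₂ _+_ (offDiagonal-diag {suc n} (λ _ _ → c) u)
                   (sum-cong-≗ (λ j → offDiagonal-off {suc n} (λ _ _ → c) (punchInᵢ≢i u j ∘ ≡.sym))) ⟩
    ∑[ j < n ] c
      ≡⟨ sum-const n c ⟩
    n * c ∎

pairSum≤∑∑ : ∀ {n} (f : Fin n → Fin n → ℕ) → pairSum f ≤ ∑[ u < n ] ∑[ v < n ] f u v
pairSum≤∑∑ f rewrite pairSum≡∑∑ f = sum-mono-≤ (λ u → sum-mono-≤ (offDiagonal-≤ f u))

pairSum-cong : ∀ {n} {f g : Fin n → Fin n → ℕ} → (∀ u v → f u v ≡ g u v) → pairSum f ≡ pairSum g
pairSum-cong f≡g = ≤-antisym (pairSum-mono-≤ λ u v _ → ≤-reflexive (f≡g u v))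
                             (pairSum-mono-≤ λ u v _ → ≤-reflexive (≡.sym (f≡g u v)))

pairSum-snoc : ∀ {n} (f : Fin (suc n) → Fin (suc n) → ℕ) →
               pairSum f ≡ pairSum (f on inject₁) + ∑[ u < n ] f (inject₁ u) (fromℕ n)
                                                  + ∑[ v < n ] f (fromℕ n) (inject₁ v)
pairSum-snoc {n} f = begin
  pairSum f
    ≡⟨ pairSum≡∑∑ f ⟩
  ∑[ u < suc n ] ∑[ v < suc n ] offDiagonal f u v
    ≡⟨ sum-init-last (λ u → ∑[ v < suc n ] offDiagonal f u v) ⟩
  ∑[ u < n ] ∑[ v < suc n ] offDiagonal f (inject₁ u) v + ∑[ v < suc n ] offDiagonal f z v
    ≡⟨ cong₂ _+_ (sum-cong-≗ (λ u → sum-init-last (offDiagonal f (inject₁ u)))) (sum-init-last (offDiagonal f z)) ⟩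
  ∑[ u < n ] (∑[ v < n ] offDiagonal f (inject₁ u) (inject₁ v) + offDiagonal f (inject₁ u) z)
    + (∑[ v < n ] offDiagonal f z (inject₁ v) + offDiagonal f z z)
    ≡⟨ cong₂ _+_ (sum-cong-≗ λ u → cong₂ _+_ (sum-cong-≗ (λ v → ≡.sym (offDiagonal-reindex f inject₁-injective u v)))
                                            (offDiagonal-off f (fromℕ≢inject₁ {i = u} ∘ ≡.sym)))
                 (cong₂ _+_ (sum-cong-≗ λ v → offDiagonal-off f (fromℕ≢inject₁ {i = v})) (offDiagonal-diag f z)) ⟩
  ∑[ u < n ] (∑[ v < n ] offDiagonal (f on inject₁) u v + f (inject₁ u) z) + (∑[ v < n ] f z (inject₁ v) + 0)
    ≡⟨ cong₂ _+_ (∑-distrib-+ (λ u → ∑[ v < n ] offDiagonal (f on inject₁) u v) (λ u → f (inject₁ u) z))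
                 (+-identityʳ (∑[ v < n ] f z (inject₁ v))) ⟩
  ∑[ u < n ] ∑[ v < n ] offDiagonal (f on inject₁) u v + ∑[ u < n ] f (inject₁ u) z + ∑[ v < n ] f z (inject₁ v)
    ≡⟨ cong (λ s → s + ∑[ u < n ] f (inject₁ u) z + ∑[ v < n ] f z (inject₁ v)) (pairSum≡∑∑ (f on inject₁)) ⟨
  pairSum (f on inject₁) + ∑[ u < n ] f (inject₁ u) z + ∑[ v < n ] f z (inject₁ v) ∎
  where
  open ≡-Reasoning
  z : Fin (suc n)
  z = fromℕ n

-- Directed paths

DisjointInteriors : ∀ {n} → List (Fin n) → List (Fin n) → Set
DisjointInteriors I J = I ≢ J × (∀ w → w ∈ I → w ∈ J → ⊥)

DisjointInteriors-sym : ∀ {n} {I J : List (Fin n)} → DisjointInteriors I J → DisjointInteriors J I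
DisjointInteriors-sym (I≢J , disjoint) = I≢J ∘ ≡.sym , λ w w∈J w∈I → disjoint w w∈I w∈J

firstOr : ∀ {n} → Fin n → List (Fin n) → Fin n
firstOr v []      = v
firstOr v (w ∷ _) = w

lastOr : ∀ {n} → Fin n → List (Fin n) → Fin n
lastOr u []       = u
lastOr u (w ∷ ws) = lastOr w ws

firstOr-cases : ∀ {n} (v : Fin n) I → (I ≡ [] × firstOr v I ≡ v) ⊎ firstOr v I ∈ I
firstOr-cases v []      = inj₁ (refl , refl)
firstOr-cases v (w ∷ I) = inj₂ (here refl)

lastOr-cases : ∀ {n} (u : Fin n) I → (I ≡ [] × lastOr u I ≡ u) ⊎ lastOr u I ∈ I
lastOr-cases u []      = inj₁ (refl , refl)
lastOr-cases u (w ∷ I) with lastOr-cases w I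
... | inj₁ (refl , _) = inj₂ (here refl)
... | inj₂ ∈I         = inj₂ (there ∈I)

module _ {n} {G : Graph n} {D : Orientation G} where

  vertices : ∀ {u v} → Path D u v → List (Fin n)
  vertices {u} {v} p = u ∷ interior p ++ v ∷ []

  second : ∀ {u v} → Path D u v → Fin n
  second {v = v} p = firstOr v (interior p)

  penultimate : ∀ {u v} → Path D u v → Fin n
  penultimate {u} p = lastOr u (interior p)

  arc-second : ∀ {u v} (p : Path D u v) → Arc D u (second p)
  arc-second p = go (interior p) (chain p)
    where
    go : ∀ {u v} I → ArcChain D u I v → Arc D u (firstOr v I)
    go []      u→v       = u→v
    go (w ∷ I) (u→w , _) = u→w

  arc-penultimate : ∀ {u v} (p : Path D u v) → Arc D (penultimate p) v
  arc-penultimate p = go (interior p) (chain p)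
    where
    go : ∀ {u v} I → ArcChain D u I v → Arc D (lastOr u I) v
    go []      u→v      = u→v
    go (w ∷ I) (_ , w⇝v) = go I w⇝v

  interior-≢-source : ∀ {u v} (p : Path D u v) {w} → w ∈ interior p → w ≢ u
  interior-≢-source p w∈I w≡u with distinct p
  ... | u∉ ∷ _ = All.lookup u∉ (∈-++⁺ˡ w∈I) (≡.sym w≡u)

  interior-≢-target : ∀ {u v} (p : Path D u v) {w} → w ∈ interior p → w ≢ v
  interior-≢-target p with distinct p
  ... | _ ∷ unique = go (interior p) unique
    where
    go : ∀ {v w} I → Unique (I ++ v ∷ []) → w ∈ I → w ≢ v
    go (x ∷ I) (x∉ ∷ _)     (here refl) = All.lookup x∉ (∈-++⁺ʳ I (here refl))
    go (x ∷ I) (_ ∷ unique) (there w∈I) = go I unique w∈I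

  second-≢ : ∀ {u v} (p q : Path D u v) → DisjointInteriors (interior p) (interior q) → second p ≢ second q
  second-≢ {v = v} p q (I≢J , disjoint) eq with firstOr-cases v (interior p) | firstOr-cases v (interior q)
  ... | inj₁ (I≡[] , _) | inj₁ (J≡[] , _) = I≢J (≡.trans I≡[] (≡.sym J≡[]))
  ... | inj₁ (_ , p≡v)  | inj₂ ∈J         = interior-≢-target q ∈J (≡.trans (≡.sym eq) p≡v)
  ... | inj₂ ∈I         | inj₁ (_ , q≡v)  = interior-≢-target p ∈I (≡.trans eq q≡v)
  ... | inj₂ ∈I         | inj₂ ∈J         = disjoint _ ∈I (subst (_∈ interior q) (≡.sym eq) ∈J)

  penultimate-≢ : ∀ {u v} (p q : Path D u v) → DisjointInteriors (interior p) (interior q) →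
                  penultimate p ≢ penultimate q
  penultimate-≢ {u} p q (I≢J , disjoint) eq with lastOr-cases u (interior p) | lastOr-cases u (interior q)
  ... | inj₁ (I≡[] , _) | inj₁ (J≡[] , _) = I≢J (≡.trans I≡[] (≡.sym J≡[]))
  ... | inj₁ (_ , p≡u)  | inj₂ ∈J         = interior-≢-source q ∈J (≡.trans (≡.sym eq) p≡u)
  ... | inj₂ ∈I         | inj₁ (_ , q≡u)  = interior-≢-source p ∈I (≡.trans eq q≡u)
  ... | inj₂ ∈I         | inj₂ ∈J         = disjoint _ ∈I (subst (_∈ interior q) (≡.sym eq) ∈J)

  prepend : ∀ {u w v} → Arc D u w → (p : Path D w v) → u ∉ vertices p → Path D u v
  prepend u→w p u∉p = record
    { interior = _ ∷ interior p
    ; chain    = u→w , chain p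
    ; distinct = ¬Any⇒All¬ _ u∉p ∷ distinct p
    }

  append : ∀ {u w v} (p : Path D u w) → Arc D w v → v ∉ vertices p → Path D u v
  append p w→v v∉p = record
    { interior = interior p ++ _ ∷ []
    ; chain    = snoc (interior p) (chain p) w→v
    ; distinct = Unique.++⁺ (distinct p) ([] ∷ []) λ { (v∈p , here refl) → v∉p v∈p }
    }
    where
    snoc : ∀ {s t r} I → ArcChain D s I t → Arc D t r → ArcChain D s (I ++ t ∷ []) r
    snoc []      s→t       t→r = s→t , t→r
    snoc (x ∷ I) (s→x , c) t→r = s→x , snoc I c t→r

  arcPath : ∀ {u v} → Arc D u v → Path D u v
  arcPath u→v = record
    { interior = []
    ; chain    = u→v
    ; distinct = ((λ { refl → irrefl G (arc-edge D u→v) }) ∷ []) ∷ [] ∷ []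
    }

  singlePath : ∀ {u v} → Path D u v → HasDisjointPaths D u v 1
  singlePath p = (λ _ → p) , λ { zero zero 0≢0 → ⊥-elim (0≢0 refl) }

  addPath : ∀ {u v k} ((ps , _) : HasDisjointPaths D u v k) (q : Path D u v) →
            (∀ i → DisjointInteriors (interior q) (interior (ps i))) → HasDisjointPaths D u v (suc k)
  addPath {u} {v} {k} (ps , ps-disjoint) q q-disjoint = family , disjoint
    where
    family : Fin (suc k) → Path D u v
    family zero    = q
    family (suc i) = ps i
    disjoint : ∀ i j → i ≢ j → DisjointInteriors (interior (family i)) (interior (family j))
    disjoint zero    zero    0≢0 = ⊥-elim (0≢0 refl)
    disjoint zero    (suc j) _   = q-disjoint j
    disjoint (suc i) zero    _   = DisjointInteriors-sym (q-disjoint i)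
    disjoint (suc i) (suc j) i≢j = ps-disjoint i j (i≢j ∘ cong suc)

module _ {m n} {G : Graph m} {H : Graph n} {D : Orientation G} {E : Orientation H}
         (φ : Fin m → Fin n) (φ-injective : Injective _≡_ _≡_ φ)
         (φ-arc : ∀ {s t} → Arc D s t → Arc E (φ s) (φ t)) where

  mapPath : ∀ {u v} → Path D u v → Path E (φ u) (φ v)
  mapPath {u} {v} p = record
    { interior = map φ (interior p)
    ; chain    = mapChain (interior p) (chain p)
    ; distinct = subst Unique (vertices-map (interior p)) (Unique.map⁺ φ-injective (distinct p))
    }
    where
    mapChain : ∀ {s t} I → ArcChain D s I t → ArcChain E (φ s) (map φ I) (φ t)
    mapChain []      s→t       = φ-arc s→t
    mapChain (w ∷ I) (s→w , c) = φ-arc s→w , mapChain I c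
    vertices-map : ∀ I → map φ (u ∷ I ++ v ∷ []) ≡ φ u ∷ map φ I ++ φ v ∷ []
    vertices-map I = cong (φ u ∷_) (map-++ φ I (v ∷ []))

  vertices-mapPath : ∀ {u v} (p : Path D u v) → vertices (mapPath p) ≡ map φ (vertices p)
  vertices-mapPath {u} {v} p = ≡.sym (cong (φ u ∷_) (map-++ φ (interior p) (v ∷ [])))

  mapDisjointPaths : ∀ {u v k} → HasDisjointPaths D u v k → HasDisjointPaths E (φ u) (φ v) k
  mapDisjointPaths (ps , ps-disjoint) = mapPath ∘ ps , λ i j i≢j → mapDisjoint (ps-disjoint i j i≢j)
    where
    mapDisjoint : ∀ {I J} → DisjointInteriors I J → DisjointInteriors (map φ I) (map φ J)
    mapDisjoint (I≢J , disjoint) = I≢J ∘ map-injective φ-injective , λ w w∈I w∈J →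
      let x , x∈I , w≡φx = ∈-map⁻ φ w∈I
          y , y∈J , w≡φy = ∈-map⁻ φ w∈J
      in  disjoint x x∈I (subst (_∈ _) (φ-injective (≡.trans (≡.sym w≡φy) w≡φx)) y∈J)

distinct⇒injective : ∀ {k} {A : Set} (f : Fin k → A) → (∀ i j → i ≢ j → f i ≢ f j) → Injective _≡_ _≡_ f
distinct⇒injective f f-distinct {i} {j} fi≡fj with i ≟ j
... | yes i≡j = i≡j
... | no  i≢j = ⊥-elim (f-distinct i j i≢j fi≡fj)

injective⊎⇒≤ : ∀ {k l d} (f : Fin k ⊎ Fin l → Fin d) → Injective _≡_ _≡_ f → k + l ≤ d
injective⊎⇒≤ {k} {l} f f-inj = injective⇒≤ {f = f ∘ splitAt k} λ {i} {j} eq →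
  ≡.trans (≡.sym (join-splitAt k l i)) (≡.trans (cong (join k l) (f-inj eq)) (join-splitAt k l j))

pathsFrom+pathsTo≤degree : ∀ {n d} {G : Graph n} (D : Orientation G) {u v k l} (ι : Fin n → Fin d) →
  (∀ {x y} → Adj G u x → Adj G u y → ι x ≡ ι y → x ≡ y) →
  HasDisjointPaths D u v k → HasDisjointPaths D v u l → k + l ≤ d
pathsFrom+pathsTo≤degree {n} {G = G} D {u} {k = k} {l} ι ι-inj (ps , ps-disjoint) (qs , qs-disjoint) =
  injective⊎⇒≤ (ι ∘ neighbour) λ {x} {y} → neighbour-injective x y ∘ ι-inj (adjacent x) (adjacent y)
  where
  neighbour : Fin k ⊎ Fin l → Fin n
  neighbour (inj₁ i) = second (ps i)
  neighbour (inj₂ j) = penultimate (qs j)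

  adjacent : ∀ x → Adj G u (neighbour x)
  adjacent (inj₁ i) = arc-edge D (arc-second (ps i))
  adjacent (inj₂ j) = sym G (arc-edge D (arc-penultimate (qs j)))

  neighbour-injective : ∀ x y → neighbour x ≡ neighbour y → x ≡ y
  neighbour-injective (inj₁ i) (inj₁ j) eq =
    cong inj₁ (distinct⇒injective (second ∘ ps) (λ i j i≢j → second-≢ (ps i) (ps j) (ps-disjoint i j i≢j)) eq)
  neighbour-injective (inj₂ i) (inj₂ j) eq =
    cong inj₂ (distinct⇒injective (penultimate ∘ qs) (λ i j i≢j → penultimate-≢ (qs i) (qs j) (qs-disjoint i j i≢j)) eq)
  neighbour-injective (inj₁ i) (inj₂ j) eq =
    ⊥-elim (antisym D (arc-second (ps i)) (subst (λ x → Arc D x u) (≡.sym eq) (arc-penultimate (qs j))))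
  neighbour-injective (inj₂ j) (inj₁ i) eq =
    ⊥-elim (antisym D (arc-second (ps i)) (subst (λ x → Arc D x u) eq (arc-penultimate (qs j))))

-- Computing κ

module MaximumClique {A : Set} (_≟A_ : DecidableEquality A) {R : Rel A 0ℓ} (R? : Decidable R)
                     (R-sym : Symmetric R) (R-irrefl : ∀ {x} → ¬ R x x) where

  cliqueNumberWithin : ℕ → List A → ℕ
  cliqueNumberWithin zero       _        = 0
  cliqueNumberWithin (suc fuel) []       = 0
  cliqueNumberWithin (suc fuel) (x ∷ xs) =
    cliqueNumberWithin fuel xs ⊔ suc (cliqueNumberWithin fuel (filter (R? x) xs))

  cliqueNumber : List A → ℕ
  cliqueNumber xs = cliqueNumberWithin (length xs) xs

  cliqueNumberWithin-attained : ∀ fuel xs →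
    ∃ λ ys → ys ⊆ xs × AllPairs R ys × length ys ≡ cliqueNumberWithin fuel xs
  cliqueNumberWithin-attained zero       xs       = [] , (λ ()) , [] , refl
  cliqueNumberWithin-attained (suc fuel) []       = [] , (λ ()) , [] , refl
  cliqueNumberWithin-attained (suc fuel) (x ∷ xs)
    with ⊔-sel (cliqueNumberWithin fuel xs) (suc (cliqueNumberWithin fuel (filter (R? x) xs)))
  ... | inj₁ eq =
    let ys , ys⊆xs , clique , |ys| = cliqueNumberWithin-attained fuel xs
    in  ys , there ∘ ys⊆xs , clique , ≡.trans |ys| (≡.sym eq)
  ... | inj₂ eq =
    let ys , ys⊆ , clique , |ys| = cliqueNumberWithin-attained fuel (filter (R? x) xs)
    in  x ∷ ys , (λ { (here refl) → here refl ; (there y∈) → there (proj₁ (∈-filter⁻ (R? x) (ys⊆ y∈))) })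
      , All.tabulate (λ y∈ → proj₂ (∈-filter⁻ (R? x) {xs = xs} (ys⊆ y∈))) ∷ clique
      , ≡.trans (cong suc |ys|) (≡.sym eq)

  -- Either x is not in the clique, or the rest of the clique consists of R-neighbours of x.
  cliqueNumberWithin-maximal : ∀ fuel xs → length xs ≤ fuel →
    ∀ ys → ys ⊆ xs → AllPairs R ys → length ys ≤ cliqueNumberWithin fuel xs
  cliqueNumberWithin-maximal _ [] _ [] _ _ = z≤n
  cliqueNumberWithin-maximal _ [] _ (y ∷ _) ys⊆[] _ with ys⊆[] (here refl)
  ... | ()
  cliqueNumberWithin-maximal (suc fuel) (x ∷ xs) (s≤s |xs|≤fuel) ys ys⊆ clique with member? _≟A_ x ys
  ... | no x∉ys = ≤-trans (cliqueNumberWithin-maximal fuel xs |xs|≤fuel ys ys⊆xs clique) (m≤m⊔n _ _)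
    where
    ys⊆xs : ys ⊆ xs
    ys⊆xs y∈ with ys⊆ y∈
    ... | here refl = ⊥-elim (x∉ys y∈)
    ... | there y∈xs = y∈xs
  ... | yes x∈ys with ∈-∃++ x∈ys
  ...   | as , bs , refl = begin
    length (as ++ x ∷ bs)                               ≡⟨ length-++-sucʳ as x bs ⟩
    suc (length (as ++ bs))                             ≤⟨ s≤s rest≤ ⟩
    suc (cliqueNumberWithin fuel (filter (R? x) xs))     ≤⟨ m≤n⊔m _ _ ⟩
    cliqueNumberWithin (suc fuel) (x ∷ xs)              ∎
    where
    open ≤-Reasoning
    x∷rest : AllPairs R (x ∷ as ++ bs)
    x∷rest = AllPairs-resp-↭ (≡.setoid A) R-sym (≡.resp₂ R) (shift (≡.setoid A) refl as bs) clique
    ∈-++-insert : ∀ {y} → y ∈ as ++ bs → y ∈ as ++ x ∷ bs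
    ∈-++-insert y∈ with ∈-++⁻ as y∈
    ... | inj₁ y∈as = ∈-++⁺ˡ y∈as
    ... | inj₂ y∈bs = ∈-++⁺ʳ as (there y∈bs)
    rest⊆ : as ++ bs ⊆ filter (R? x) xs
    rest⊆ {y} y∈rest with All.lookup (AllPairs.head x∷rest) y∈rest
    ... | xRy with ys⊆ (∈-++-insert y∈rest)
    ...   | here refl  = ⊥-elim (R-irrefl xRy)
    ...   | there y∈xs = ∈-filter⁺ (R? x) y∈xs xRy
    rest≤ : length (as ++ bs) ≤ cliqueNumberWithin fuel (filter (R? x) xs)
    rest≤ = cliqueNumberWithin-maximal fuel _ (≤-trans (length-filter (R? x) xs) |xs|≤fuel)
              (as ++ bs) rest⊆ (AllPairs.tail x∷rest)

  cliqueNumber-attained : ∀ xs → ∃ λ ys → ys ⊆ xs × AllPairs R ys × length ys ≡ cliqueNumber xs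
  cliqueNumber-attained xs = cliqueNumberWithin-attained (length xs) xs

  cliqueNumber-maximal : ∀ xs ys → ys ⊆ xs → AllPairs R ys → length ys ≤ cliqueNumber xs
  cliqueNumber-maximal xs = cliqueNumberWithin-maximal (length xs) xs (≤-reflexive refl)

listsUpTo : ∀ {n} → ℕ → List (List (Fin n))
listsUpTo     zero    = [] ∷ []
listsUpTo {n} (suc k) = [] ∷ cartesianProductWith _∷_ (allFin n) (listsUpTo k)

∈-listsUpTo : ∀ {n} k (I : List (Fin n)) → length I ≤ k → I ∈ listsUpTo k
∈-listsUpTo zero    []      _           = here refl
∈-listsUpTo (suc k) []      _           = here refl
∈-listsUpTo (suc k) (x ∷ I) (s≤s |I|≤k) =
  there (∈-cartesianProductWith⁺ _∷_ (∈-allFin x) (∈-listsUpTo k I |I|≤k))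

lookup-injective : ∀ {A : Set} {xs : List A} → Unique xs → Injective _≡_ _≡_ (lookup xs)
lookup-injective {xs = x ∷ xs} _            {zero}  {zero}  _  = refl
lookup-injective {xs = x ∷ xs} (x∉ ∷ _)     {zero}  {suc j} eq = ⊥-elim (All.lookup x∉ (∈-lookup j) eq)
lookup-injective {xs = x ∷ xs} (x∉ ∷ _)     {suc i} {zero}  eq = ⊥-elim (All.lookup x∉ (∈-lookup i) (≡.sym eq))
lookup-injective {xs = x ∷ xs} (_ ∷ unique) {suc i} {suc j} eq = cong suc (lookup-injective unique eq)

Unique⇒length≤ : ∀ {n} {xs : List (Fin n)} → Unique xs → length xs ≤ n
Unique⇒length≤ unique = injective⇒≤ (lookup-injective unique)

AllPairs-lookup : ∀ {A : Set} {R : Rel A 0ℓ} → Symmetric R → ∀ {xs} → AllPairs R xs →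
                  ∀ i j → i ≢ j → R (lookup xs i) (lookup xs j)
AllPairs-lookup R-sym (_   ∷ _) zero    zero    i≢j = ⊥-elim (i≢j refl)
AllPairs-lookup R-sym (xR ∷ _) zero    (suc j) _   = All.lookup xR (∈-lookup j)
AllPairs-lookup R-sym (xR ∷ _) (suc i) zero    _   = R-sym (All.lookup xR (∈-lookup i))
AllPairs-lookup R-sym (_  ∷ rs) (suc i) (suc j) i≢j = AllPairs-lookup R-sym rs i j (i≢j ∘ cong suc)

disjointInteriors? : ∀ {n} → Decidable (DisjointInteriors {n})
disjointInteriors? I J =
  ¬? (≡-dec _≟_ I J) ×-dec
  map′ (λ disjoint w w∈I w∈J → disjoint (w∈I , w∈J)) (λ disjoint {w} (w∈I , w∈J) → disjoint w w∈I w∈J)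
       (disjoint? _≟_ I J)

module _ {n} {G : Graph n} (D : Orientation G) (arc? : ∀ u v → Dec (Arc D u v)) where

  IsInterior : Fin n → Fin n → List (Fin n) → Set
  IsInterior u v I = ArcChain D u I v × Unique (u ∷ I ++ v ∷ [])

  isInterior? : ∀ u v I → Dec (IsInterior u v I)
  isInterior? u v I = arcChain? u I ×-dec Unique.unique? _≟_ (u ∷ I ++ v ∷ [])
    where
    arcChain? : ∀ s I → Dec (ArcChain D s I v)
    arcChain? s []      = arc? s v
    arcChain? s (w ∷ I) = arc? s w ×-dec arcChain? w I

  interiors : Fin n → Fin n → List (List (Fin n))
  interiors u v = filter (isInterior? u v) (listsUpTo n)

  interior∈interiors : ∀ {u v} (p : Path D u v) → interior p ∈ interiors u v
  interior∈interiors {u} {v} p with distinct p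
  ... | _ ∷ unique = ∈-filter⁺ (isInterior? u v)
    (∈-listsUpTo n (interior p) (≤-trans (length-++-≤ˡ (interior p)) (Unique⇒length≤ unique)))
    (chain p , distinct p)

  open MaximumClique (≡-dec _≟_) (disjointInteriors? {n}) DisjointInteriors-sym (λ (I≢I , _) → I≢I refl)

  kappa : Fin n → Fin n → ℕ
  kappa u v = cliqueNumber (interiors u v)

  kappa-isKappa : ∀ u v → IsKappa D u v (kappa u v)
  kappa-isKappa u v with cliqueNumber-attained (interiors u v)
  ... | ys , ys⊆ , clique , |ys| = subst (HasDisjointPaths D u v) |ys| (path , disjoint) , maximal
    where
    valid : ∀ i → IsInterior u v (lookup ys i)
    valid i = proj₂ (∈-filter⁻ (isInterior? u v) {xs = listsUpTo n} (ys⊆ (∈-lookup i)))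
    path : Fin (length ys) → Path D u v
    path i = record { interior = lookup ys i ; chain = proj₁ (valid i) ; distinct = proj₂ (valid i) }
    disjoint : ∀ i j → i ≢ j → DisjointInteriors (interior (path i)) (interior (path j))
    disjoint = AllPairs-lookup DisjointInteriors-sym clique
    maximal : ∀ m → HasDisjointPaths D u v m → m ≤ kappa u v
    maximal m (ps , ps-disjoint) = ≤-trans (≤-reflexive (≡.sym (length-tabulate (interior ∘ ps))))
      (cliqueNumber-maximal (interiors u v) _
        (λ I∈ → let i , I≡ = ∈-tabulate⁻ I∈ in subst (_∈ interiors u v) (≡.sym I≡) (interior∈interiors (ps i)))
        (AllPairs.tabulate⁺ (ps-disjoint _ _)))

-- Lower bound

record GoodOrientation {n} (G : Graph n) : Set₁ where
  field
    orientation   : Orientation G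
    arc?          : ∀ u v → Dec (Arc orientation u v)
    path          : ∀ {u v} → u ≢ v → Path orientation u v
    weight        : Fin n → Fin n → ℕ
    disjointPaths : ∀ {u v} → u ≢ v → HasDisjointPaths orientation u v (weight u v)
    bound≤weight  : bound n ≤ pairSum weight

good⇒lowerBound : ∀ {n} {G : Graph n} → GoodOrientation G →
  Σ (Orientation G) λ D → Σ (Fin n → Fin n → ℕ) λ κ → KappaOf D κ × (bound n ≤ pairSum κ)
good⇒lowerBound {n} good =
  orientation , κ , (λ u v _ → kappa-isKappa orientation arc? u v) ,
  ≤-trans bound≤weight (pairSum-mono-≤ weight≤κ)
  where
  open GoodOrientation good
  κ : Fin n → Fin n → ℕ
  κ = kappa orientation arc?
  weight≤κ : ∀ u v → u ≢ v → weight u v ≤ κ u v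
  weight≤κ u v u≢v = proj₂ (kappa-isKappa orientation arc? u v) _ (disjointPaths u≢v)

permute-good : ∀ {n} {G H : Graph n} (π : Permutation′ n) →
  (∀ i j → Adj H i j ⇔ Adj G (π ⟨$⟩ʳ i) (π ⟨$⟩ʳ j)) → GoodOrientation G → GoodOrientation H
permute-good {n} {G} {H} π H≅G good = record
  { orientation   = E
  ; arc?          = λ u v → arc? (σ u) (σ v)
  ; path          = λ u≢v → restore {Path E} (mapPath τ τ-injective τ-arc (path (u≢v ∘ σ-injective)))
  ; weight        = λ u v → weight (σ u) (σ v)
  ; disjointPaths = λ {u} {v} u≢v → restore {λ s t → HasDisjointPaths E s t (weight (σ u) (σ v))}
                      (mapDisjointPaths τ τ-injective τ-arc (disjointPaths (u≢v ∘ σ-injective)))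
  ; bound≤weight  = ≤-trans bound≤weight (≤-reflexive (≡.sym (pairSum-permute π weight)))
  }
  where
  open GoodOrientation good renaming (orientation to D)
  σ τ : Fin n → Fin n
  σ = π ⟨$⟩ʳ_
  τ = π ⟨$⟩ˡ_
  σ-injective : Injective _≡_ _≡_ σ
  σ-injective = permute-injective π
  τ-injective : Injective _≡_ _≡_ τ
  τ-injective = permute-injective (inverse π)
  E : Orientation H
  E = record
    { Arc      = λ i j → Arc D (σ i) (σ j)
    ; arc-edge = from (H≅G _ _) ∘ arc-edge D
    ; edge-arc = edge-arc D ∘ to (H≅G _ _)
    ; antisym  = antisym D
    }
  τ-arc : ∀ {s t} → Arc D s t → Arc E (τ s) (τ t)
  τ-arc = subst₂ (Arc D) (≡.sym (inverseʳ π)) (≡.sym (inverseʳ π))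
  restore : ∀ {P : Fin n → Fin n → Set} {u v} → P (τ (σ u)) (τ (σ v)) → P u v
  restore {P} = subst₂ P (inverseˡ π) (inverseˡ π)

next : Fin 3 → Fin 3
next zero             = suc zero
next (suc zero)       = suc (suc zero)
next (suc (suc zero)) = zero

complete₃-good : ∀ {H : Graph 3} → (∀ i j → i ≢ j → Adj H i j) → GoodOrientation H
complete₃-good {H} complete = record
  { orientation   = D
  ; arc?          = λ u v → v ≟ next u
  ; path          = path
  ; weight        = λ _ _ → 1
  ; disjointPaths = singlePath ∘ path
  ; bound≤weight  = ≤-refl
  }
  where
  next-≢ : ∀ i → i ≢ next i
  next-≢ zero             ()
  next-≢ (suc zero)       ()
  next-≢ (suc (suc zero)) ()
  edge-next : ∀ i j → Adj H i j → j ≡ next i ⊎ i ≡ next j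
  edge-next zero             (suc zero)       _ = inj₁ refl
  edge-next zero             (suc (suc zero)) _ = inj₂ refl
  edge-next (suc zero)       zero             _ = inj₂ refl
  edge-next (suc zero)       (suc (suc zero)) _ = inj₁ refl
  edge-next (suc (suc zero)) zero             _ = inj₁ refl
  edge-next (suc (suc zero)) (suc zero)       _ = inj₂ refl
  edge-next zero             zero             i~i = ⊥-elim (irrefl H i~i)
  edge-next (suc zero)       (suc zero)       i~i = ⊥-elim (irrefl H i~i)
  edge-next (suc (suc zero)) (suc (suc zero)) i~i = ⊥-elim (irrefl H i~i)
  D : Orientation H
  D = record
    { Arc      = λ i j → j ≡ next i
    ; arc-edge = λ { {i} refl → complete i (next i) (next-≢ i) }
    ; edge-arc = λ {i} {j} → edge-next i j
    ; antisym  = λ { {zero} refl () ; {suc zero} refl () ; {suc (suc zero)} refl () }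
    }
  path : ∀ {u v} → u ≢ v → Path D u v
  path {zero}             {suc zero}       _ = arcPath refl
  path {suc zero}         {suc (suc zero)} _ = arcPath refl
  path {suc (suc zero)}   {zero}           _ = arcPath refl
  path {zero}             {suc (suc zero)} _ = prepend refl (arcPath refl) λ { (here ()) ; (there (here ())) }
  path {suc zero}         {zero}           _ = prepend refl (arcPath refl) λ { (here ()) ; (there (here ())) }
  path {suc (suc zero)}   {suc zero}       _ = prepend refl (arcPath refl) λ { (here ()) ; (there (here ())) }
  path {zero}             {zero}           0≢0 = ⊥-elim (0≢0 refl)
  path {suc zero}         {suc zero}       1≢1 = ⊥-elim (1≢1 refl)
  path {suc (suc zero)}   {suc (suc zero)} 2≢2 = ⊥-elim (2≢2 refl)

twoTree-order≥2 : ∀ {n} {G : Graph n} → IsTwoTree n G → 2 ≤ n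
twoTree-order≥2 (base _ _)               = ≤-refl
twoTree-order≥2 (step _ T _ _ _ _ _ _)   = m≤n⇒m≤1+n (twoTree-order≥2 T)
twoTree-order≥2 (iso _ T _ _ _)          = twoTree-order≥2 T

twoTree₂-complete : ∀ {G : Graph 2} → IsTwoTree 2 G → ∀ i j → i ≢ j → Adj G i j
twoTree₂-complete (base G K₂)            i j i≢j = from (K₂ i j) i≢j
twoTree₂-complete (step _ T _ _ _ _ _ _) with twoTree-order≥2 T
... | s≤s ()
twoTree₂-complete (iso G T H π H≅G)      i j i≢j =
  from (H≅G i j) (twoTree₂-complete T _ _ (i≢j ∘ permute-injective π))

Fin2-cover : ∀ {x y : Fin 2} → x ≢ y → ∀ i → i ≡ x ⊎ i ≡ y
Fin2-cover {zero}     {zero}     0≢0 _          = ⊥-elim (0≢0 refl)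
Fin2-cover {suc zero} {suc zero} 1≢1 _          = ⊥-elim (1≢1 refl)
Fin2-cover {zero}     {suc zero} _   zero       = inj₁ refl
Fin2-cover {zero}     {suc zero} _   (suc zero) = inj₂ refl
Fin2-cover {suc zero} {zero}     _   zero       = inj₂ refl
Fin2-cover {suc zero} {zero}     _   (suc zero) = inj₁ refl

triangle-complete : ∀ {G : Graph 2} {H : Graph 3} {x y} → IsTwoTree 2 G → Adj G x y →
  (∀ i j → Adj H (inject₁ i) (inject₁ j) ⇔ Adj G i j) →
  (∀ i → Adj H (fromℕ 2) (inject₁ i) ⇔ (i ≡ x ⊎ i ≡ y)) →
  ∀ i j → i ≢ j → Adj H i j
triangle-complete {G} {H} T x~y old-adj new-adj = complete
  where
  old : ∀ i j → i ≢ j → Adj H (inject₁ i) (inject₁ j)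
  old i j i≢j = from (old-adj i j) (twoTree₂-complete T i j i≢j)
  new : ∀ i → Adj H (fromℕ 2) (inject₁ i)
  new i = from (new-adj i) (Fin2-cover (λ { refl → irrefl G x~y }) i)
  complete : ∀ i j → i ≢ j → Adj H i j
  complete zero             (suc zero)       _ = old zero (suc zero) λ ()
  complete (suc zero)       zero             _ = old (suc zero) zero λ ()
  complete (suc (suc zero)) zero             _ = new zero
  complete (suc (suc zero)) (suc zero)       _ = new (suc zero)
  complete zero             (suc (suc zero)) _ = sym H (new zero)
  complete (suc zero)       (suc (suc zero)) _ = sym H (new (suc zero))
  complete zero             zero             0≢0 = ⊥-elim (0≢0 refl)
  complete (suc zero)       (suc zero)       1≢1 = ⊥-elim (1≢1 refl)
  complete (suc (suc zero)) (suc (suc zero)) 2≢2 = ⊥-elim (2≢2 refl)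

bound-suc-≤ : ∀ n → bound (suc n) ≤ bound n + 1 + n + n
bound-suc-≤ zero                = z≤n
bound-suc-≤ (suc zero)          = n≤1+n 2
bound-suc-≤ (suc (suc zero))    = n≤1+n 6
bound-suc-≤ (suc (suc (suc k))) = ≤-reflexive (identity k)
  where
  identity : ∀ k → (4 + k) * (3 + k) + (1 + k) ≡ (3 + k) * (2 + k) + k + 1 + (3 + k) + (3 + k)
  identity = solve-∀

fromℕ∉map-inject₁ : ∀ {n} (xs : List (Fin n)) → fromℕ n ∉ map inject₁ xs
fromℕ∉map-inject₁ xs z∈ with ∈-map⁻ inject₁ z∈
... | _ , _ , z≡ = fromℕ≢inject₁ z≡

module Extension {n} {G : Graph n} {H : Graph (suc n)} (good : GoodOrientation G)
  {a b : Fin n} (a→b : Arc (GoodOrientation.orientation good) a b)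
  (old-adj : ∀ i j → Adj H (inject₁ i) (inject₁ j) ⇔ Adj G i j)
  (new-adj : ∀ i → Adj H (fromℕ n) (inject₁ i) ⇔ (i ≡ a ⊎ i ≡ b)) where

  open GoodOrientation good renaming (orientation to D)

  z : Fin (suc n)
  z = fromℕ n

  a≢b : a ≢ b
  a≢b refl = irrefl G (arc-edge D a→b)

  ArcOnViews : ∀ {i j : Fin (suc n)} → View i → View j → Set
  ArcOnViews (‵inject₁ i) (‵inject₁ j) = Arc D i j
  ArcOnViews (‵inject₁ i) ‵fromℕ       = i ≡ a
  ArcOnViews ‵fromℕ       (‵inject₁ j) = j ≡ b
  ArcOnViews ‵fromℕ       ‵fromℕ       = ⊥

  arc-edge′ : ∀ {i j : Fin (suc n)} (vi : View i) (vj : View j) → ArcOnViews vi vj → Adj H i j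
  arc-edge′ (‵inject₁ i) (‵inject₁ j) i→j = from (old-adj i j) (arc-edge D i→j)
  arc-edge′ (‵inject₁ i) ‵fromℕ       i≡a = sym H (from (new-adj i) (inj₁ i≡a))
  arc-edge′ ‵fromℕ       (‵inject₁ j) j≡b = from (new-adj j) (inj₂ j≡b)

  edge-arc′ : ∀ {i j : Fin (suc n)} (vi : View i) (vj : View j) → Adj H i j →
              ArcOnViews vi vj ⊎ ArcOnViews vj vi
  edge-arc′ (‵inject₁ i) (‵inject₁ j) i~j = edge-arc D (to (old-adj i j) i~j)
  edge-arc′ (‵inject₁ i) ‵fromℕ       i~z = to (new-adj i) (sym H i~z)
  edge-arc′ ‵fromℕ       (‵inject₁ j) z~j = ⊎.swap (to (new-adj j) z~j)
  edge-arc′ ‵fromℕ       ‵fromℕ       z~z = ⊥-elim (irrefl H z~z)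

  antisym′ : ∀ {i j : Fin (suc n)} (vi : View i) (vj : View j) → ArcOnViews vi vj → ArcOnViews vj vi → ⊥
  antisym′ (‵inject₁ i) (‵inject₁ j) i→j j→i = antisym D i→j j→i
  antisym′ (‵inject₁ i) ‵fromℕ       i≡a i≡b = a≢b (≡.trans (≡.sym i≡a) i≡b)
  antisym′ ‵fromℕ       (‵inject₁ j) j≡b j≡a = a≢b (≡.trans (≡.sym j≡a) j≡b)

  E : Orientation H
  E = record
    { Arc      = λ i j → ArcOnViews (view i) (view j)
    ; arc-edge = λ {i} {j} → arc-edge′ (view i) (view j)
    ; edge-arc = λ {i} {j} → edge-arc′ (view i) (view j)
    ; antisym  = λ {i} {j} → antisym′ (view i) (view j)
    }

  arcOnViews? : ∀ {i j : Fin (suc n)} (vi : View i) (vj : View j) → Dec (ArcOnViews vi vj)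
  arcOnViews? (‵inject₁ i) (‵inject₁ j) = arc? i j
  arcOnViews? (‵inject₁ i) ‵fromℕ       = i ≟ a
  arcOnViews? ‵fromℕ       (‵inject₁ j) = j ≟ b
  arcOnViews? ‵fromℕ       ‵fromℕ       = no λ ()

  old-arc : ∀ {i j} → Arc D i j → Arc E (inject₁ i) (inject₁ j)
  old-arc {i} {j} = subst₂ ArcOnViews (≡.sym (view-inject₁ i)) (≡.sym (view-inject₁ j))

  a→z : Arc E (inject₁ a) z
  a→z = subst₂ ArcOnViews (≡.sym (view-inject₁ a)) (≡.sym (view-fromℕ n)) refl

  z→b : Arc E z (inject₁ b)
  z→b = subst₂ ArcOnViews (≡.sym (view-fromℕ n)) (≡.sym (view-inject₁ b)) refl

  lift : ∀ {u v} → Path D u v → Path E (inject₁ u) (inject₁ v)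
  lift = mapPath inject₁ inject₁-injective old-arc

  z∉lift : ∀ {u v} (p : Path D u v) → z ∉ vertices (lift p)
  z∉lift p = subst (z ∉_) (≡.sym (vertices-mapPath {E = E} inject₁ inject₁-injective old-arc p))
                          (fromℕ∉map-inject₁ (vertices p))

  detour : Path E (inject₁ a) (inject₁ b)
  detour = prepend a→z (arcPath z→b) λ { (here a≡z) → fromℕ≢inject₁ (≡.sym a≡z)
                                       ; (there (here a≡b)) → a≢b (inject₁-injective a≡b) }

  toNew : ∀ i → Path E (inject₁ i) z
  toNew i with i ≟ a
  ... | yes refl = arcPath a→z
  ... | no  i≢a  = append (lift (path i≢a)) a→z (z∉lift (path i≢a))

  fromNew : ∀ j → Path E z (inject₁ j)
  fromNew j with b ≟ j
  ... | yes refl = arcPath z→b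
  ... | no  b≢j  = prepend z→b (lift (path b≢j)) (z∉lift (path b≢j))

  path′ : ∀ {i j : Fin (suc n)} (vi : View i) (vj : View j) → i ≢ j → Path E i j
  path′ (‵inject₁ i) (‵inject₁ j) i≢j = lift (path (i≢j ∘ cong inject₁))
  path′ (‵inject₁ i) ‵fromℕ       _   = toNew i
  path′ ‵fromℕ       (‵inject₁ j) _   = fromNew j
  path′ ‵fromℕ       ‵fromℕ       z≢z = ⊥-elim (z≢z refl)

  detourCount : Fin n → Fin n → ℕ
  detourCount i j with i ≟ a | j ≟ b
  ... | yes _ | yes _ = 1
  ... | _     | _     = 0

  detourCount-ab : detourCount a b ≡ 1
  detourCount-ab with a ≟ a | b ≟ b
  ... | yes _   | yes _   = refl
  ... | no  a≢a | _       = ⊥-elim (a≢a refl)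
  ... | yes _   | no  b≢b = ⊥-elim (b≢b refl)

  weightOnViews : ∀ {i j : Fin (suc n)} → View i → View j → ℕ
  weightOnViews (‵inject₁ i) (‵inject₁ j) = weight i j + detourCount i j
  weightOnViews (‵inject₁ i) ‵fromℕ       = 1
  weightOnViews ‵fromℕ       (‵inject₁ j) = 1
  weightOnViews ‵fromℕ       ‵fromℕ       = 0

  weight′ : Fin (suc n) → Fin (suc n) → ℕ
  weight′ i j = weightOnViews (view i) (view j)

  liftAll : ∀ {u v k} → HasDisjointPaths D u v k → HasDisjointPaths E (inject₁ u) (inject₁ v) k
  liftAll = mapDisjointPaths inject₁ inject₁-injective old-arc

  detour-disjoint : ∀ I → DisjointInteriors (interior detour) (map inject₁ I)
  detour-disjoint I = (λ eq → fromℕ∉map-inject₁ I (subst (z ∈_) eq (here refl)))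
                    , λ { w (here refl) → fromℕ∉map-inject₁ I }

  oldPaths : ∀ i j → i ≢ j → HasDisjointPaths E (inject₁ i) (inject₁ j) (weight i j + detourCount i j)
  oldPaths i j i≢j with i ≟ a | j ≟ b
  ... | yes refl | yes refl = subst (HasDisjointPaths E _ _) (+-comm 1 (weight a b))
    (addPath (liftAll (disjointPaths i≢j)) detour (detour-disjoint ∘ interior ∘ proj₁ (disjointPaths i≢j)))
  ... | yes _    | no  _    = subst (HasDisjointPaths E _ _) (≡.sym (+-identityʳ _)) (liftAll (disjointPaths i≢j))
  ... | no  _    | _        = subst (HasDisjointPaths E _ _) (≡.sym (+-identityʳ _)) (liftAll (disjointPaths i≢j))

  disjointPaths′ : ∀ {i j : Fin (suc n)} (vi : View i) (vj : View j) → i ≢ j →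
                   HasDisjointPaths E i j (weightOnViews vi vj)
  disjointPaths′ (‵inject₁ i) (‵inject₁ j) i≢j = oldPaths i j (i≢j ∘ cong inject₁)
  disjointPaths′ (‵inject₁ i) ‵fromℕ       _   = singlePath (toNew i)
  disjointPaths′ ‵fromℕ       (‵inject₁ j) _   = singlePath (fromNew j)
  disjointPaths′ ‵fromℕ       ‵fromℕ       z≢z = ⊥-elim (z≢z refl)

  weight′-bound : bound (suc n) ≤ pairSum weight′
  weight′-bound = begin
    bound (suc n)                                          ≤⟨ bound-suc-≤ n ⟩
    bound n + 1 + n + n                                    ≤⟨ +-monoˡ-≤ n (+-monoˡ-≤ n (+-mono-≤ bound≤weight 1≤detours)) ⟩
    pairSum weight + pairSum detourCount + n + n           ≡⟨ cong (λ s → s + n + n) (pairSum-+ weight detourCount) ⟨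
    pairSum (λ i j → weight i j + detourCount i j) + n + n ≡⟨ cong₂ _+_ (cong₂ _+_ old-pairs into-z) out-of-z ⟩
    pairSum (weight′ on inject₁) + ∑[ i < n ] weight′ (inject₁ i) z + ∑[ j < n ] weight′ z (inject₁ j)
                                                           ≡⟨ pairSum-snoc weight′ ⟨
    pairSum weight′                                        ∎
    where
    open ≤-Reasoning
    1≤detours : 1 ≤ pairSum detourCount
    1≤detours = subst (_≤ pairSum detourCount) detourCount-ab (≤-pairSum detourCount a≢b)
    old-pairs : pairSum (λ i j → weight i j + detourCount i j) ≡ pairSum (weight′ on inject₁)
    old-pairs = pairSum-cong λ i j → ≡.sym (cong₂ weightOnViews (view-inject₁ i) (view-inject₁ j))
    sum-ones : ∀ {f : Fin n → ℕ} → (∀ i → f i ≡ 1) → n ≡ sum f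
    sum-ones f≡1 = ≡.sym (≡.trans (sum-cong-≗ f≡1) (≡.trans (sum-const n 1) (*-identityʳ n)))
    into-z : n ≡ ∑[ i < n ] weight′ (inject₁ i) z
    into-z = sum-ones λ i → cong₂ weightOnViews (view-inject₁ i) (view-fromℕ n)
    out-of-z : n ≡ ∑[ j < n ] weight′ z (inject₁ j)
    out-of-z = sum-ones λ j → cong₂ weightOnViews (view-fromℕ n) (view-inject₁ j)

  extension-good : GoodOrientation H
  extension-good = record
    { orientation   = E
    ; arc?          = λ i j → arcOnViews? (view i) (view j)
    ; path          = λ {i} {j} → path′ (view i) (view j)
    ; weight        = weight′
    ; disjointPaths = λ {i} {j} → disjointPaths′ (view i) (view j)
    ; bound≤weight  = weight′-bound
    }

extend-good : ∀ {n} {G : Graph n} {H : Graph (suc n)} {x y} → GoodOrientation G → Adj G x y →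
  (∀ i j → Adj H (inject₁ i) (inject₁ j) ⇔ Adj G i j) →
  (∀ i → Adj H (fromℕ n) (inject₁ i) ⇔ (i ≡ x ⊎ i ≡ y)) → GoodOrientation H
extend-good good x~y old-adj new-adj with edge-arc (GoodOrientation.orientation good) x~y
... | inj₁ x→y = Extension.extension-good good x→y old-adj new-adj
... | inj₂ y→x = Extension.extension-good good y→x old-adj λ i →
                   mk⇔ (⊎.swap ∘ to (new-adj i)) (from (new-adj i) ∘ ⊎.swap)

twoTree-good : ∀ {n} {G : Graph n} → IsTwoTree n G → 3 ≤ n → GoodOrientation G
twoTree-good (base _ _) (s≤s (s≤s ()))
twoTree-good (step {zero} _ T _ _ _ _ _ _) _ with twoTree-order≥2 T
... | ()
twoTree-good (step {suc zero} _ T _ _ _ _ _ _) _ with twoTree-order≥2 T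
... | s≤s ()
twoTree-good (step {suc (suc zero)} _ T _ _ x~y H old-adj new-adj) _ =
  complete₃-good (triangle-complete {H = H} T x~y old-adj new-adj)
twoTree-good (step {suc (suc (suc _))} _ T _ _ x~y _ old-adj new-adj) _ =
  extend-good (twoTree-good T (s≤s (s≤s (s≤s z≤n)))) x~y old-adj new-adj
twoTree-good (iso _ T _ π H≅G) 3≤n = permute-good π H≅G (twoTree-good T 3≤n)

-- Sharpness

IsHub : ∀ {n} → Fin n → Set
IsHub zero          = ⊤
IsHub (suc zero)    = ⊤
IsHub (suc (suc _)) = ⊥

book : ∀ m → Graph (2 + m)
book m = record
  { Adj    = λ i j → i ≢ j × (IsHub i ⊎ IsHub j)
  ; sym    = λ (i≢j , hub) → i≢j ∘ ≡.sym , ⊎.swap hub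
  ; irrefl = λ (i≢i , _) → i≢i refl
  }

IsHub-inject₁ : ∀ {m} (i : Fin (2 + m)) → IsHub (inject₁ i) ⇔ IsHub i
IsHub-inject₁ zero          = mk⇔ id id
IsHub-inject₁ (suc zero)    = mk⇔ id id
IsHub-inject₁ (suc (suc i)) = mk⇔ id id

book-isTwoTree : ∀ m → IsTwoTree (2 + m) (book m)
book-isTwoTree zero    = base (book 0) λ i j → mk⇔ proj₁ (λ i≢j → i≢j , inj₁ (hub i))
  where
  hub : ∀ (i : Fin 2) → IsHub i
  hub zero       = tt
  hub (suc zero) = tt
book-isTwoTree (suc m) =
  step (book m) (book-isTwoTree m) zero (suc zero) ((λ ()) , inj₁ tt) (book (suc m)) old-adj new-adj
  where
  old-adj : ∀ i j → Adj (book (suc m)) (inject₁ i) (inject₁ j) ⇔ Adj (book m) i j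
  old-adj i j = mk⇔
    (λ (i≢j , hub) → i≢j ∘ cong inject₁ , ⊎.map (to (IsHub-inject₁ i)) (to (IsHub-inject₁ j)) hub)
    (λ (i≢j , hub) → i≢j ∘ inject₁-injective , ⊎.map (from (IsHub-inject₁ i)) (from (IsHub-inject₁ j)) hub)
  new-adj : ∀ i → Adj (book (suc m)) (fromℕ (2 + m)) (inject₁ i) ⇔ (i ≡ zero ⊎ i ≡ suc zero)
  new-adj i = mk⇔ (λ { (_ , inj₂ hub) → hub-cases i hub })
                  (λ { (inj₁ refl) → fromℕ≢inject₁ , inj₂ tt ; (inj₂ refl) → fromℕ≢inject₁ , inj₂ tt })
    where
    hub-cases : ∀ i → IsHub (inject₁ i) → i ≡ zero ⊎ i ≡ suc zero
    hub-cases zero       _ = inj₁ refl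
    hub-cases (suc zero) _ = inj₂ refl

module _ {m} (D : Orientation (book m)) where

  nonHub-paths≤2 : ∀ i {v k l} → HasDisjointPaths D (suc (suc i)) v k → HasDisjointPaths D v (suc (suc i)) l →
                   k + l ≤ 2
  nonHub-paths≤2 i = pathsFrom+pathsTo≤degree D hubIndex hubIndex-injective
    where
    hubIndex : Fin (2 + m) → Fin 2
    hubIndex zero    = zero
    hubIndex (suc _) = suc zero
    neighbour-hub : ∀ {x} → Adj (book m) (suc (suc i)) x → IsHub x
    neighbour-hub (_ , inj₂ hub) = hub
    hubIndex-injective : ∀ {x y} → Adj (book m) (suc (suc i)) x → Adj (book m) (suc (suc i)) y →
                         hubIndex x ≡ hubIndex y → x ≡ y
    hubIndex-injective {zero}        {zero}        _   _   _ = refl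
    hubIndex-injective {suc zero}    {suc zero}    _   _   _ = refl
    hubIndex-injective {suc (suc _)} {_}           w~x _   _ = ⊥-elim (neighbour-hub w~x)
    hubIndex-injective {_}           {suc (suc _)} _   w~y _ = ⊥-elim (neighbour-hub w~y)

  hub-paths≤ : ∀ {k l} → HasDisjointPaths D zero (suc zero) k → HasDisjointPaths D (suc zero) zero l → k + l ≤ suc m
  hub-paths≤ = pathsFrom+pathsTo≤degree D identify₀₁ identify₀₁-injective
    where
    identify₀₁ : Fin (2 + m) → Fin (1 + m)
    identify₀₁ zero    = zero
    identify₀₁ (suc i) = i
    identify₀₁-injective : ∀ {x y} → Adj (book m) zero x → Adj (book m) zero y → identify₀₁ x ≡ identify₀₁ y → x ≡ y
    identify₀₁-injective {zero} (0≢0 , _) _         _  = ⊥-elim (0≢0 refl)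
    identify₀₁-injective {_} {zero} _      (0≢0 , _) _  = ⊥-elim (0≢0 refl)
    identify₀₁-injective {suc _} {suc _} _ _ eq = cong suc eq

spine : ∀ {n} → ℕ → Fin n → Fin n → ℕ
spine k zero       (suc zero) = k
spine k (suc zero) zero       = k
spine k _          _          = 0

pairSum-spine≤ : ∀ k → pairSum {3 + k} (spine k) ≤ k + k
pairSum-spine≤ k = ≤-trans (pairSum≤∑∑ {3 + k} (spine k)) (≤-reflexive (begin
  (k + Z (1 + k)) + ((k + Z (1 + k)) + ∑[ i < 1 + k ] Z (3 + k))
    ≡⟨ cong₂ (λ z w → (k + z) + ((k + z) + w)) (sum-replicate-zero (1 + k))
             (≡.trans (sum-cong-≗ {1 + k} λ _ → sum-replicate-zero (3 + k)) (sum-replicate-zero (1 + k))) ⟩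
  (k + 0) + ((k + 0) + 0)
    ≡⟨ identity k ⟩
  k + k ∎))
  where
  open ≡-Reasoning
  Z : ℕ → ℕ
  Z n = ∑[ i < n ] 0
  identity : ∀ k → (k + 0) + ((k + 0) + 0) ≡ k + k
  identity = solve-∀

book-pairSum≤ : ∀ k (D : Orientation (book (suc k))) (κ : Fin (3 + k) → Fin (3 + k) → ℕ) → KappaOf D κ →
                pairSum κ ≤ bound (3 + k)
book-pairSum≤ k D κ isκ = *-cancelˡ-≤ 2 (begin
  2 * pairSum κ                         ≡⟨ cong (pairSum κ +_) (+-identityʳ (pairSum κ)) ⟩
  pairSum κ + pairSum κ                 ≡⟨ cong (pairSum κ +_) (pairSum-flip κ) ⟨
  pairSum κ + pairSum (flip κ)          ≡⟨ pairSum-+ κ (flip κ) ⟨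
  pairSum (λ u v → κ u v + κ v u)       ≤⟨ pairSum-mono-≤ pair≤ ⟩
  pairSum (λ u v → two u v + spine′ u v) ≡⟨ pairSum-+ two spine′ ⟩
  pairSum two + pairSum spine′          ≤⟨ +-monoʳ-≤ (pairSum two) (pairSum-spine≤ k) ⟩
  pairSum two + (k + k)                 ≡⟨ cong (_+ (k + k)) (pairSum-const (2 + k) 2) ⟩
  (3 + k) * ((2 + k) * 2) + (k + k)     ≡⟨ identity k ⟩
  2 * bound (3 + k)                     ∎)
  where
  open ≤-Reasoning
  identity : ∀ k → (3 + k) * ((2 + k) * 2) + (k + k) ≡ 2 * ((3 + k) * (2 + k) + k)
  identity = solve-∀
  two spine′ : Fin (3 + k) → Fin (3 + k) → ℕ
  two _ _ = 2
  spine′  = spine k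
  paths : ∀ {u v} → u ≢ v → HasDisjointPaths D u v (κ u v)
  paths {u} {v} u≢v = proj₁ (isκ u v u≢v)
  nonHub≤2 : ∀ {i v} → suc (suc i) ≢ v → κ (suc (suc i)) v + κ v (suc (suc i)) ≤ 2
  nonHub≤2 i≢v = nonHub-paths≤2 D _ (paths i≢v) (paths (i≢v ∘ ≡.sym))
  hubs≤ : κ zero (suc zero) + κ (suc zero) zero ≤ 2 + k
  hubs≤ = hub-paths≤ D (paths (λ ())) (paths (λ ()))
  commute : ∀ {u v b} → κ v u + κ u v ≤ b → κ u v + κ v u ≤ b
  commute {u} {v} {b} = subst (_≤ b) (+-comm (κ v u) (κ u v))
  pair≤ : ∀ u v → u ≢ v → κ u v + κ v u ≤ two u v + spine′ u v
  pair≤ (suc (suc i)) v             i≢v = ≤-trans (nonHub≤2 i≢v) (m≤m+n 2 _)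
  pair≤ zero          (suc (suc j)) 0≢j = commute (nonHub≤2 (0≢j ∘ ≡.sym))
  pair≤ (suc zero)    (suc (suc j)) 1≢j = commute (nonHub≤2 (1≢j ∘ ≡.sym))
  pair≤ zero          (suc zero)    _   = hubs≤
  pair≤ (suc zero)    zero          _   = commute hubs≤
  pair≤ zero          zero          0≢0 = ⊥-elim (0≢0 refl)
  pair≤ (suc zero)    (suc zero)    1≢1 = ⊥-elim (1≢1 refl)

theorem5p5 :
    ((n : ℕ) → 3 ≤ n → (G : Graph n) → IsTwoTree n G →
      Σ (Orientation G) λ D → Σ (_ → _ → ℕ) λ κ → KappaOf D κ × (bound n ≤ pairSum κ))
    ×
    ((n : ℕ) → 3 ≤ n →
      Σ (Graph n) λ G → IsTwoTree n G ×
        ((D : Orientation G) (κ : _ → _ → ℕ) → KappaOf D κ → pairSum κ ≤ bound n))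
theorem5p5 = (λ n 3≤n G T → good⇒lowerBound (twoTree-good T 3≤n)) , sharp
  where
  sharp : (n : ℕ) → 3 ≤ n →
          Σ (Graph n) λ G → IsTwoTree n G ×
            ((D : Orientation G) (κ : Fin n → Fin n → ℕ) → KappaOf D κ → pairSum κ ≤ bound n)
  sharp (suc (suc (suc k))) _           = book (suc k) , book-isTwoTree (suc k) , book-pairSum≤ k
  sharp (suc zero)          (s≤s ())
  sharp (suc (suc zero))    (s≤s (s≤s ()))
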